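{- Let $G$ be a $K_4$-free bridged graph, $u$ a vertex of $G$ and $k\ge 0$. Then the sphere $S_k(u)=\{v: d_G(u,v)=k\}$ contains no three pairwise adjacent vertices.
   Context: All graphs are finite, simple, undirected and connected; $d_G$ denotes the shortest-path distance of $G$. A graph $G$ is bridged if every isometric cycle of $G$ has length $3$; a cycle $C$ is isometric if $d_C=d_G$ on its vertices. $G$ is $K_4$-free if it has no four pairwise adjacent vertices. -}

module Defs where

open import Data.Nat using (ℕ; zero; suc; _≤_; _≥_; ∣_-_∣; _⊓_; _∸_)
open import Data.Fin using (Fin; toℕ)
open import Data.Product using (Σ; ∃; _×_; _,_)
open import Data.Sum using (_⊎_)
open import Data.Empty using (⊥)
open import Relation.Nullary using (¬_)
open import Relation.Binary.PropositionalEquality using (_≡_)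
open import Function.Definitions using (Injective)

record Graph : Set₁ where
  field
    n       : ℕ
    Adj     : Fin n → Fin n → Set
    sym     : ∀ {x y} → Adj x y → Adj y x
    irrefl  : ∀ {x} → ¬ Adj x x

module _ (G : Graph) where
  open Graph G

  data Walk : Fin n → Fin n → ℕ → Set where
    here : ∀ {x} → Walk x x 0
    step : ∀ {x y z k} → Adj x y → Walk y z k → Walk x z (suc k)

  Connected : Set
  Connected = ∀ x y → ∃ λ k → Walk x y k

  Dist : Fin n → Fin n → ℕ → Set
  Dist x y k = Walk x y k × (∀ m → Walk x y m → k ≤ m)

  Consecutive : (m : ℕ) → Fin m → Fin m → Set
  Consecutive m i j = (suc (toℕ i) ≡ toℕ j) ⊎ ((suc (toℕ i) ≡ m) × (toℕ j ≡ 0))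

  record Cycle : Set where
    field
      len     : ℕ
      len≥3   : len ≥ 3
      vtx     : Fin len → Fin n
      inj     : Injective _≡_ _≡_ vtx
      adj     : ∀ i j → Consecutive len i j → Adj (vtx i) (vtx j)

  cycDist : ℕ → ℕ → ℕ → ℕ
  cycDist m i j = ∣ i - j ∣ ⊓ (m ∸ ∣ i - j ∣)

  Isometric : Cycle → Set
  Isometric C = ∀ i j → Dist (vtx i) (vtx j) (cycDist len (toℕ i) (toℕ j))
    where open Cycle C

  Bridged : Set
  Bridged = ∀ (C : Cycle) → Isometric C → Cycle.len C ≡ 3

  K4-free : Set
  K4-free = ∀ a b c d → Adj a b → Adj a c → Adj a d → Adj b c → Adj b d → Adj c d → ⊥

  InSphere : Fin n → ℕ → Fin n → Set
  InSphere u k v = Dist u v k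

module Submission where

-- Fix a base vertex a and call d(a,v) the level of v.  Two local conditions
-- hold in every bridged graph, for every base vertex and every m:
--   TC m (triangle condition): two adjacent vertices of level m+1 have a
--        common neighbour of level m;
--   SC m (square condition): two neighbours of level m of a vertex of level
--        m+1 are equal or adjacent.
-- The theorem follows by descent: for a triangle in S_{k+1}(u), TC gives
-- vertices of level k below its three edges; K4-freeness makes them distinct
-- and SC makes them pairwise adjacent, so they form a triangle in S_k(u); and
-- S_0(u) = {u} contains no edge.

open import Defs
open import Data.Nat using (ℕ; zero; suc; _+_; _∸_; _≤_; _<_; _⊓_; z≤n; s≤s; _≟_; _≤?_; _<?_)
open import Data.Nat.Properties
open import Data.Fin using (Fin; toℕ)
open import Data.Fin.Properties using (toℕ-injective; toℕ<n)
open import Data.Product using (Σ; _×_; _,_; proj₁; proj₂)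
open import Data.Sum using (_⊎_; inj₁; inj₂)
open import Data.Empty using (⊥; ⊥-elim)
open import Relation.Nullary using (¬_; Dec; yes; no)
open import Relation.Nullary.Decidable.Core using (decidable-stable; ¬¬-excluded-middle)
open import Relation.Binary.Definitions using (tri<; tri≈; tri>)
open import Relation.Binary.PropositionalEquality using (_≡_; refl; sym; trans; cong; cong₂; subst; subst₂; module ≡-Reasoning)
open import Data.Nat.Tactic.RingSolver using (solve-∀)

∸-from-+ : ∀ {a b c} → b + c ≡ a → a ∸ c ≡ b
∸-from-+ {b = b} {c} refl = m+n∸n≡m b c

between-t-and-t+2 : ∀ {t D} → t ≤ D → D ≤ suc (suc t) →
  (D ≡ t) ⊎ ((D ≡ suc t) ⊎ (D ≡ suc (suc t)))
between-t-and-t+2 t≤D D≤t+2 with m≤n⇒m<n∨m≡n D≤t+2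
... | inj₂ D≡t+2 = inj₂ (inj₂ D≡t+2)
... | inj₁ (s≤s D≤t+1) with m≤n⇒m<n∨m≡n D≤t+1
...   | inj₂ D≡t+1 = inj₂ (inj₁ D≡t+1)
...   | inj₁ (s≤s D≤t) = inj₁ (≤-antisym D≤t t≤D)

replaceAt : {A : Set} → (ℕ → A) → ℕ → A → ℕ → A
replaceAt f j w l with l ≟ j
... | yes _ = w
... | no _ = f l

replaceAt-≡ : ∀ {A : Set} (f : ℕ → A) j w → replaceAt f j w j ≡ w
replaceAt-≡ f j w with j ≟ j
... | yes _ = refl
... | no j≢j = ⊥-elim (j≢j refl)

replaceAt-≢ : ∀ {A : Set} (f : ℕ → A) j w l → ¬ (l ≡ j) → replaceAt f j w l ≡ f l
replaceAt-≢ f j w l l≢j with l ≟ j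
... | yes l≡j = ⊥-elim (l≢j l≡j)
... | no _ = refl

module _ (G : Graph) where
  open Graph G renaming (sym to Adj-sym)

  V : Set
  V = Fin n

  _++ʷ_ : ∀ {x y z k l} → Walk G x y k → Walk G y z l → Walk G x z (k + l)
  here ++ʷ q = q
  step e p ++ʷ q = step e (p ++ʷ q)

  edgeʷ : ∀ {x y} → Adj x y → Walk G x y 1
  edgeʷ e = step e here

  snocʷ : ∀ {x y z k} → Walk G x y k → Adj y z → Walk G x z (suc k)
  snocʷ {k = k} p e = subst (Walk G _ _) (+-comm k 1) (p ++ʷ edgeʷ e)

  reverseʷ : ∀ {x y k} → Walk G x y k → Walk G y x k
  reverseʷ here = here
  reverseʷ (step e p) = snocʷ (reverseʷ p) (Adj-sym e)

  walk0⇒≡ : ∀ {x y} → Walk G x y 0 → x ≡ y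
  walk0⇒≡ here = refl

  walk1⇒Adj : ∀ {x y} → Walk G x y 1 → Adj x y
  walk1⇒Adj (step e here) = e

  Adj⇒≢ : ∀ {x y} → Adj x y → ¬ (x ≡ y)
  Adj⇒≢ e refl = irrefl e

  -- LB x y t : every walk from x to y has length at least t, i.e. d(x,y) ≥ t.
  -- Isometry of a cycle is established through such lower bounds.
  LB : V → V → ℕ → Set
  LB x y t = ∀ ℓ → Walk G x y ℓ → t ≤ ℓ

  LB-mono : ∀ {x y s t} → s ≤ t → LB x y t → LB x y s
  LB-mono s≤t lb ℓ w = ≤-trans s≤t (lb ℓ w)

  LB-cast : ∀ {x y s t} → LB x y s → s ≡ t → LB x y t
  LB-cast lb refl = lb

  LB-sym : ∀ {x y t} → LB x y t → LB y x t
  LB-sym lb ℓ w = lb ℓ (reverseʷ w)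

  LB-0 : ∀ {x y} → LB x y 0
  LB-0 _ _ = z≤n

  LB-adj : ∀ {x y} → Adj x y → LB x y 1
  LB-adj e zero w = ⊥-elim (Adj⇒≢ e (walk0⇒≡ w))
  LB-adj e (suc ℓ) w = s≤s z≤n

  LB-nonadj : ∀ {x y} → ¬ (x ≡ y) → ¬ Adj x y → LB x y 2
  LB-nonadj x≢y _ zero w = ⊥-elim (x≢y (walk0⇒≡ w))
  LB-nonadj _ ¬xy (suc zero) w = ⊥-elim (¬xy (walk1⇒Adj w))
  LB-nonadj _ _ (suc (suc ℓ)) w = s≤s (s≤s z≤n)

  LB-stable : ∀ {x y t} → ¬ ¬ LB x y t → LB x y t
  LB-stable {t = t} ¬¬lb ℓ w = decidable-stable (t ≤? ℓ) λ t≰ℓ → ¬¬lb λ lb → t≰ℓ (lb ℓ w)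

  Dist-unique : ∀ {x y k k′} → Dist G x y k → Dist G x y k′ → k ≡ k′
  Dist-unique (w , lb) (w′ , lb′) = ≤-antisym (lb _ w′) (lb′ _ w)

  Dist-sym : ∀ {x y k} → Dist G x y k → Dist G y x k
  Dist-sym (w , lb) = reverseʷ w , LB-sym lb

  Dist0⇒≡ : ∀ {x y} → Dist G x y 0 → x ≡ y
  Dist0⇒≡ (w , _) = walk0⇒≡ w

  Dist-refl : ∀ {x} → Dist G x x 0
  Dist-refl = here , λ _ _ → z≤n

  Dist-cast : ∀ {x y D k} → Dist G x y D → k ≤ D → D ≤ k → Dist G x y k
  Dist-cast DD k≤D D≤k = subst (Dist G _ _) (≤-antisym D≤k k≤D) DD

  level-gap : ∀ {a x y dx dy} → Dist G a x dx → Dist G a y dy → LB x y (dx ∸ dy)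
  level-gap {dx = dx} {dy} (_ , lbx) (wy , _) ℓ p = m≤n+o⇒m∸n≤o dx dy (lbx _ (wy ++ʷ reverseʷ p))

  level-gap′ : ∀ {a x y dx dy} → Dist G a x dx → Dist G a y dy → LB x y (dy ∸ dx)
  level-gap′ Dx Dy = LB-sym (level-gap Dy Dx)

  level-walk : ∀ {a x y dx dy ℓ} → Dist G a x dx → Dist G a y dy → Walk G x y ℓ → dy ≤ dx + ℓ
  level-walk (wx , _) (_ , lby) p = lby _ (wx ++ʷ p)

  level-adj : ∀ {a x y dx dy} → Adj x y → Dist G a x dx → Dist G a y dy → dy ≤ suc dx
  level-adj {dx = dx} {dy} e Dx Dy = subst (dy ≤_) (+-comm dx 1) (level-walk Dx Dy (edgeʷ e))

  level-≢ : ∀ {a x y dx dy} → Dist G a x dx → Dist G a y dy → ¬ (dx ≡ dy) → ¬ (x ≡ y)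
  level-≢ Dx Dy dx≢dy refl = dx≢dy (Dist-unique Dx Dy)

  level-¬Adj : ∀ {a x y dx dy} → Dist G a x dx → Dist G a y dy → suc (suc dy) ≤ dx → ¬ Adj x y
  level-¬Adj Dx Dy gap e = <-irrefl refl (≤-trans gap (level-adj (Adj-sym e) Dy Dx))

  -- Shortest
  -- walks need not be computable (adjacency is not decidable), so the
  -- statement is double-negated; the proofs below only ever refute.

  module _ (conn : Connected G) where
    private
      Shorter : V → V → ℕ → Set
      Shorter x y k = Σ ℕ λ ℓ → ℓ < k × Walk G x y ℓ

      bounded : ∀ {x y} b k → k ≤ b → Walk G x y k → ¬ ¬ Σ ℕ (Dist G x y)
      bounded {x} {y} b k k≤b w ¬D = ¬¬-excluded-middle {A = Shorter x y k} λ
        { (yes (ℓ , ℓ<k , w′)) → shorter b k≤b ℓ<k w′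
        ; (no none) → ¬D (k , w , λ ℓ w′ → ≮⇒≥ λ ℓ<k → none (ℓ , ℓ<k , w′)) }
        where
        shorter : ∀ b {ℓ} → k ≤ b → ℓ < k → Walk G x y ℓ → ⊥
        shorter zero k≤b ℓ<k _ = ⊥-elim (<-irrefl refl (≤-trans ℓ<k (≤-trans k≤b z≤n)))
        shorter (suc b) k≤b ℓ<k w′ = bounded b _ (≤-pred (≤-trans ℓ<k k≤b)) w′ ¬D

    withDist : ∀ x y → ¬ ¬ Σ ℕ (Dist G x y)
    withDist x y with conn x y
    ... | k , w = bounded k k ≤-refl w

  record Geodesic (a y : V) (M : ℕ) (q : ℕ → V) : Set where
    field
      start    : q 0 ≡ y
      adjacent : ∀ j → suc j ≤ M → Adj (q j) (q (suc j))
      level    : ∀ j k → j + k ≡ M → Dist G a (q j) k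

  private
    vertexAt : ∀ {x y k} → Walk G x y k → ℕ → V
    vertexAt {x} here _ = x
    vertexAt {x} (step _ w) zero = x
    vertexAt (step _ w) (suc i) = vertexAt w i

    vertexAt-0 : ∀ {x y k} (w : Walk G x y k) → vertexAt w 0 ≡ x
    vertexAt-0 here = refl
    vertexAt-0 (step _ w) = refl

    vertexAt-adj : ∀ {x y k} (w : Walk G x y k) j → suc j ≤ k →
      Adj (vertexAt w j) (vertexAt w (suc j))
    vertexAt-adj (step e w) zero _ = subst (Adj _) (sym (vertexAt-0 w)) e
    vertexAt-adj (step e w) (suc j) (s≤s j<k) = vertexAt-adj w j j<k

    prefix : ∀ {x y k} (w : Walk G x y k) j → j ≤ k → Walk G x (vertexAt w j) j
    prefix {x} w zero _ = subst (λ z → Walk G x z 0) (sym (vertexAt-0 w)) here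
    prefix (step e w) (suc j) (s≤s j≤k) = step e (prefix w j j≤k)

    suffix : ∀ {x y k} (w : Walk G x y k) j d → j + d ≡ k → Walk G (vertexAt w j) y d
    suffix here zero d refl = here
    suffix (step e w) zero d refl = step e w
    suffix (step e w) (suc j) d refl = suffix w j d refl

  -- Reading a shortest walk from y to a backwards gives a geodesic: its
  -- suffixes are shortest walks, since otherwise the whole walk could be shortened.
  geodesic : ∀ {a y M} → Dist G a y M → Σ (ℕ → V) (Geodesic a y M)
  geodesic {a} {y} {M} (w , lb) = vertexAt w⁻¹ , record
    { start = vertexAt-0 w⁻¹ ; adjacent = vertexAt-adj w⁻¹ ; level = level }
    where
    w⁻¹ : Walk G y a M
    w⁻¹ = reverseʷ w
    level : ∀ j k → j + k ≡ M → Dist G a (vertexAt w⁻¹ j) k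
    level j k j+k≡M = reverseʷ (suffix w⁻¹ j k j+k≡M) , λ ℓ p →
      let j≤M = subst (j ≤_) j+k≡M (m≤m+n j k)
          j+k≤ℓ+j = lb _ (p ++ʷ reverseʷ (prefix w⁻¹ j j≤M))
      in +-cancelˡ-≤ j k ℓ (subst₂ _≤_ (sym j+k≡M) (+-comm ℓ j) j+k≤ℓ+j)

  module _ {a y M q} (Q : Geodesic a y M q) where
    open Geodesic Q

    segment : ∀ j d → j + d ≤ M → Walk G (q j) (q (j + d)) d
    segment j zero _ = subst (λ z → Walk G (q j) (q z) 0) (sym (+-identityʳ j)) here
    segment j (suc d) j+d<M = step (adjacent j (≤-trans (s≤s (m≤m+n j d)) fits))
      (subst (λ z → Walk G (q (suc j)) (q z) d) (sym (+-suc j d)) (segment (suc j) d fits))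
      where
      fits : suc j + d ≤ M
      fits = subst (_≤ M) (+-suc j d) j+d<M

    dist-from-start : ∀ j → j ≤ M → Dist G (q j) y j
    dist-from-start j j≤M = subst (λ z → Dist G (q j) z j) start
      ( reverseʷ (segment 0 j j≤M)
      , λ ℓ p → subst (_≤ ℓ) (m∸[m∸n]≡n j≤M)
          (level-gap′ (level j (M ∸ j) (m+[n∸m]≡n j≤M)) (level 0 M refl) ℓ p) )

    LB-down : ∀ {b A T} → LB b (q A) T → ∀ s → A + s ≤ M → LB b (q (A + s)) (T ∸ s)
    LB-down {A = A} {T} lb s A+s≤M ℓ p =
      m≤n+o⇒m∸n≤o T s (subst (T ≤_) (+-comm ℓ s) (lb _ (p ++ʷ reverseʷ (segment A s A+s≤M))))

    end : q M ≡ a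
    end = sym (Dist0⇒≡ (level M 0 (+-identityʳ M)))

  -- An inner vertex q (j+1) of a geodesic may be replaced by any common
  -- neighbour w of q j and q (j+2): w is forced to have the right level.
  replace-geodesic : ∀ {a y M q w D} → Geodesic a y M q → ∀ j → suc (suc j) ≤ M →
    Adj (q j) w → Adj w (q (suc (suc j))) → Dist G a w D → Geodesic a y M (replaceAt q (suc j) w)
  replace-geodesic {a} {y} {M} {q} {w} {D} Q j j+2≤M e₀ e₂ Dw = record
    { start = trans (replaceAt-≢ q (suc j) w 0 (λ ())) start ; adjacent = adjacent′ ; level = level′ }
    where
    open Geodesic Q
    q′ : ℕ → V
    q′ = replaceAt q (suc j) w
    old : ∀ {l} → ¬ (l ≡ suc j) → q′ l ≡ q l
    old = replaceAt-≢ q (suc j) w _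
    new : q′ (suc j) ≡ w
    new = replaceAt-≡ q (suc j) w
    adjacent′ : ∀ l → suc l ≤ M → Adj (q′ l) (q′ (suc l))
    adjacent′ l l<M = by-cases (l ≟ j) (l ≟ suc j)
      where
      by-cases : Dec (l ≡ j) → Dec (l ≡ suc j) → Adj (q′ l) (q′ (suc l))
      by-cases (yes refl) _ = subst₂ Adj (sym (old (λ l≡l+1 → <-irrefl l≡l+1 ≤-refl))) (sym new) e₀
      by-cases (no _) (yes refl) = subst₂ Adj (sym new) (sym (old (λ l+2≡l+1 → <-irrefl (sym l+2≡l+1) ≤-refl))) e₂
      by-cases (no l≢j) (no l≢j+1) =
        subst₂ Adj (sym (old l≢j+1)) (sym (old (λ eq → l≢j (suc-injective eq)))) (adjacent l l<M)
    shift₀ : ∀ j k → j + suc (suc k) ≡ suc j + suc k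
    shift₀ = solve-∀
    shift₂ : ∀ j k → suc (suc j) + k ≡ suc j + suc k
    shift₂ = solve-∀
    level′ : ∀ l k → l + k ≡ M → Dist G a (q′ l) k
    level′ l k l+k≡M = by-cases (l ≟ suc j) k l+k≡M
      where
      by-cases : Dec (l ≡ suc j) → ∀ k → l + k ≡ M → Dist G a (q′ l) k
      by-cases (no l≢j+1) k l+k≡M = subst (λ u → Dist G a u k) (sym (old l≢j+1)) (level l k l+k≡M)
      by-cases (yes refl) zero l+0≡M =
        ⊥-elim (<-irrefl refl (≤-trans j+2≤M (≤-reflexive (trans (sym l+0≡M) (+-identityʳ l)))))
      by-cases (yes refl) (suc k) l+k≡M = subst (λ u → Dist G a u (suc k)) (sym new) (Dist-cast Dw above below)
        where
        above : suc k ≤ D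
        above = ≤-pred (level-adj (Adj-sym e₀) Dw (level j (suc (suc k)) (trans (shift₀ j k) l+k≡M)))
        below : D ≤ suc k
        below = level-adj (Adj-sym e₂) (level (suc (suc j)) k (trans (shift₂ j k) l+k≡M)) Dw

  module CyclicSequence (L′ : ℕ) (c : ℕ → V)
    (adjacent : ∀ k → suc k < suc L′ → Adj (c k) (c (suc k))) (closing : Adj (c L′) (c 0))
    (far : ∀ i d e → d + e ≡ suc L′ → i + d < suc L′ → LB (c i) (c (i + d)) (d ⊓ e)) where

    L : ℕ
    L = suc L′

    arc : ∀ i d → i + d < L → Walk G (c i) (c (i + d)) d
    arc i zero _ = subst (λ z → Walk G (c i) (c z) 0) (sym (+-identityʳ i)) here
    arc i (suc d) i+d<L = step (adjacent i (≤-trans (s≤s (s≤s (m≤m+n i d))) fits))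
      (subst (λ z → Walk G (c (suc i)) (c z) d) (sym (+-suc i d)) (arc (suc i) d fits))
      where
      fits : suc i + d < L
      fits = subst (_< L) (+-suc i d) i+d<L

    -- For positions I ≤ J the two arcs between them have lengths d = J − I
    -- (forward) and L − d (backward through the closing edge).
    dist-between : ∀ I J → I ≤ J → J < L → Dist G (c I) (c J) ((J ∸ I) ⊓ (L ∸ (J ∸ I)))
    dist-between I J I≤J J<L = shorter-arc , subst (λ z → LB (c I) (c z) (d ⊓ e)) I+d≡J bound
      where
      d : ℕ
      d = J ∸ I
      e : ℕ
      e = L ∸ d
      r : ℕ
      r = L′ ∸ J
      I+d≡J : I + d ≡ J
      I+d≡J = m+[n∸m]≡n I≤J
      J+r≡L′ : J + r ≡ L′
      J+r≡L′ = m+[n∸m]≡n (≤-pred J<L)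
      d+e≡L : d + e ≡ L
      d+e≡L = m+[n∸m]≡n (≤-trans (m∸n≤m J I) (<⇒≤ J<L))
      bound : LB (c I) (c (I + d)) (d ⊓ e)
      bound = far I d e d+e≡L (subst (_< L) (sym I+d≡J) J<L)
      forward : Walk G (c I) (c J) d
      forward = subst (λ z → Walk G (c I) (c z) d) I+d≡J (arc I d (subst (_< L) (sym I+d≡J) J<L))
      backward : Walk G (c J) (c I) (r + suc I)
      backward = subst (λ z → Walk G (c J) (c z) r) J+r≡L′ (arc J r (subst (_< L) (sym J+r≡L′) ≤-refl))
                 ++ʷ step closing (arc 0 I (≤-trans (s≤s I≤J) J<L))
      backward-length : r + suc I ≡ e
      backward-length = sym (∸-from-+ (begin
        r + suc I + d     ≡⟨ rearrange r I d ⟩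
        suc (I + d + r)   ≡⟨ cong (λ z → suc (z + r)) I+d≡J ⟩
        suc (J + r)       ≡⟨ cong suc J+r≡L′ ⟩
        L                 ∎))
        where
        open ≡-Reasoning
        rearrange : ∀ r I d → r + suc I + d ≡ suc (I + d + r)
        rearrange = solve-∀
      shorter-arc : Walk G (c I) (c J) (d ⊓ e)
      shorter-arc with ≤-total d e
      ... | inj₁ d≤e = subst (Walk G (c I) (c J)) (sym (m≤n⇒m⊓n≡m d≤e)) forward
      ... | inj₂ e≤d = subst (Walk G (c I) (c J)) (sym (m≥n⇒m⊓n≡n e≤d))
                         (reverseʷ (subst (Walk G (c J) (c I)) backward-length backward))

    injective : ∀ I J → I < J → J < L → ¬ (c I ≡ c J)
    injective I J I<J J<L cI≡cJ =
      <-irrefl refl (≤-trans positive (proj₂ (dist-between I J (<⇒≤ I<J) J<L) 0 (subst (λ z → Walk G (c I) z 0) cI≡cJ here)))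
      where
      positive : 0 < (J ∸ I) ⊓ (L ∸ (J ∸ I))
      positive = ⊓-glb (m<n⇒0<n∸m I<J) (m<n⇒0<n∸m (≤-<-trans (m∸n≤m J I) J<L))

    cycle : 3 ≤ L′ → Cycle G
    cycle 3≤L′ = record { len = L ; len≥3 = ≤-trans 3≤L′ (n≤1+n L′) ; vtx = λ k → c (toℕ k)
                   ; inj = inj ; adj = adj }
      where
      inj : ∀ {i j : Fin L} → c (toℕ i) ≡ c (toℕ j) → i ≡ j
      inj {i} {j} eq with <-cmp (toℕ i) (toℕ j)
      ... | tri< i<j _ _ = ⊥-elim (injective (toℕ i) (toℕ j) i<j (toℕ<n j) eq)
      ... | tri≈ _ i≡j _ = toℕ-injective i≡j
      ... | tri> _ _ j<i = ⊥-elim (injective (toℕ j) (toℕ i) j<i (toℕ<n i) (sym eq))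
      adj : ∀ i j → Consecutive G L i j → Adj (c (toℕ i)) (c (toℕ j))
      adj i j (inj₁ next) = subst (λ z → Adj (c (toℕ i)) (c z)) next
        (adjacent (toℕ i) (subst (_< L) (sym next) (toℕ<n j)))
      adj i j (inj₂ (last , first)) = subst₂ (λ u v → Adj (c u) (c v)) (sym (suc-injective last)) (sym first) closing

    isometric : (3≤L′ : 3 ≤ L′) → Isometric G (cycle 3≤L′)
    isometric _ i j with ≤-total (toℕ i) (toℕ j)
    ... | inj₁ i≤j = subst (Dist G (c (toℕ i)) (c (toℕ j)))
            (cong (λ z → z ⊓ (L ∸ z)) (trans (sym (m≤n⇒∣n-m∣≡n∸m i≤j)) (∣-∣-comm (toℕ j) (toℕ i))))
            (dist-between (toℕ i) (toℕ j) i≤j (toℕ<n j))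
    ... | inj₂ j≤i = subst (Dist G (c (toℕ i)) (c (toℕ j)))
            (cong (λ z → z ⊓ (L ∸ z)) (sym (m≤n⇒∣n-m∣≡n∸m j≤i)))
            (Dist-sym (dist-between (toℕ j) (toℕ i) j≤i (toℕ<n i)))

  -- In a bridged graph every cycle as above has length 3; this is how all
  -- contradictions below are obtained.
  module _ (bridged : Bridged G) where

    no-isometric-cycle : ∀ L′ → 3 ≤ L′ → (c : ℕ → V) →
      (∀ k → suc k < suc L′ → Adj (c k) (c (suc k))) → Adj (c L′) (c 0) →
      (∀ i d e → d + e ≡ suc L′ → i + d < suc L′ → LB (c i) (c (i + d)) (d ⊓ e)) → ⊥
    no-isometric-cycle L′ 3≤L′ c adjacent closing far =
      <-irrefl refl (subst (3 <_) (bridged (cycle 3≤L′) (isometric 3≤L′)) (s≤s 3≤L′))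
      where open CyclicSequence L′ c adjacent closing far

    private
      beyond : ∀ {i d L} → i + d < L → L ≤ i → ⊥
      beyond {i} {d} i+d<L L≤i = <-irrefl refl (≤-trans (≤-trans (s≤s L≤i) (s≤s (m≤m+n i d))) i+d<L)

    -- No induced 4-cycle a1 a2 a3 a4: such a cycle would be isometric.
    no-induced-C4 : ∀ {a1 a2 a3 a4} → Adj a1 a2 → Adj a2 a3 → Adj a3 a4 → Adj a4 a1 →
      ¬ (a1 ≡ a3) → ¬ Adj a1 a3 → ¬ (a2 ≡ a4) → ¬ Adj a2 a4 → ⊥
    no-induced-C4 {a1} {a2} {a3} {a4} e12 e23 e34 e41 n13 m13 n24 m24 =
      no-isometric-cycle 3 (s≤s (s≤s (s≤s z≤n))) c adjacent e41 far
      where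
      c : ℕ → V
      c 0 = a1
      c 1 = a2
      c 2 = a3
      c _ = a4
      adjacent : ∀ k → suc k < 4 → Adj (c k) (c (suc k))
      adjacent 0 _ = e12
      adjacent 1 _ = e23
      adjacent 2 _ = e34
      adjacent (suc (suc (suc k))) (s≤s (s≤s (s≤s (s≤s ()))))
      far : ∀ i d e → d + e ≡ 4 → i + d < 4 → LB (c i) (c (i + d)) (d ⊓ e)
      far i 0 _ _ _ = LB-0
      far (suc (suc (suc (suc i)))) (suc d) _ _ i+d<4 = ⊥-elim (beyond {i = suc (suc (suc (suc i)))} {d = suc d} i+d<4 (s≤s (s≤s (s≤s (s≤s z≤n)))))
      far 0 1 3 refl _ = LB-adj e12
      far 1 1 3 refl _ = LB-adj e23
      far 2 1 3 refl _ = LB-adj e34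
      far 3 1 3 refl (s≤s (s≤s (s≤s (s≤s ()))))
      far 0 2 2 refl _ = LB-nonadj n13 m13
      far 1 2 2 refl _ = LB-nonadj n24 m24
      far 2 2 2 refl (s≤s (s≤s (s≤s (s≤s ()))))
      far 3 2 2 refl (s≤s (s≤s (s≤s (s≤s ()))))
      far 0 3 1 refl _ = LB-sym (LB-adj e41)
      far 1 3 1 refl (s≤s (s≤s (s≤s (s≤s ()))))
      far 2 3 1 refl (s≤s (s≤s (s≤s (s≤s ()))))
      far 3 3 1 refl (s≤s (s≤s (s≤s (s≤s ()))))
      far i 4 0 refl i+4<4 = ⊥-elim (beyond {i = 4} (subst (_< 4) (+-comm i 4) i+4<4) ≤-refl)
      far i (suc (suc (suc (suc (suc d))))) e () _

    -- No induced 5-cycle a1 … a5: such a cycle would be isometric.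
    no-induced-C5 : ∀ {a1 a2 a3 a4 a5} → Adj a1 a2 → Adj a2 a3 → Adj a3 a4 → Adj a4 a5 → Adj a5 a1 →
      ¬ (a1 ≡ a3) → ¬ Adj a1 a3 → ¬ (a1 ≡ a4) → ¬ Adj a1 a4 →
      ¬ (a2 ≡ a4) → ¬ Adj a2 a4 → ¬ (a2 ≡ a5) → ¬ Adj a2 a5 →
      ¬ (a3 ≡ a5) → ¬ Adj a3 a5 → ⊥
    no-induced-C5 {a1} {a2} {a3} {a4} {a5} e12 e23 e34 e45 e51 n13 m13 n14 m14 n24 m24 n25 m25 n35 m35 =
      no-isometric-cycle 4 (s≤s (s≤s (s≤s z≤n))) c adjacent e51 far
      where
      c : ℕ → V
      c 0 = a1
      c 1 = a2
      c 2 = a3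
      c 3 = a4
      c _ = a5
      adjacent : ∀ k → suc k < 5 → Adj (c k) (c (suc k))
      adjacent 0 _ = e12
      adjacent 1 _ = e23
      adjacent 2 _ = e34
      adjacent 3 _ = e45
      adjacent (suc (suc (suc (suc k)))) (s≤s (s≤s (s≤s (s≤s (s≤s ())))))
      far : ∀ i d e → d + e ≡ 5 → i + d < 5 → LB (c i) (c (i + d)) (d ⊓ e)
      far i 0 _ _ _ = LB-0
      far (suc (suc (suc (suc (suc i))))) (suc d) _ _ i+d<5 = ⊥-elim (beyond {i = suc (suc (suc (suc (suc i))))} {d = suc d} i+d<5 (s≤s (s≤s (s≤s (s≤s (s≤s z≤n))))))
      far 0 1 4 refl _ = LB-adj e12
      far 1 1 4 refl _ = LB-adj e23
      far 2 1 4 refl _ = LB-adj e34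
      far 3 1 4 refl _ = LB-adj e45
      far 4 1 4 refl (s≤s (s≤s (s≤s (s≤s (s≤s ())))))
      far 0 2 3 refl _ = LB-nonadj n13 m13
      far 1 2 3 refl _ = LB-nonadj n24 m24
      far 2 2 3 refl _ = LB-nonadj n35 m35
      far 3 2 3 refl (s≤s (s≤s (s≤s (s≤s (s≤s ())))))
      far 4 2 3 refl (s≤s (s≤s (s≤s (s≤s (s≤s ())))))
      far 0 3 2 refl _ = LB-nonadj n14 m14
      far 1 3 2 refl _ = LB-nonadj n25 m25
      far 2 3 2 refl (s≤s (s≤s (s≤s (s≤s (s≤s ())))))
      far 3 3 2 refl (s≤s (s≤s (s≤s (s≤s (s≤s ())))))
      far 4 3 2 refl (s≤s (s≤s (s≤s (s≤s (s≤s ())))))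
      far 0 4 1 refl _ = LB-sym (LB-adj e51)
      far 1 4 1 refl (s≤s (s≤s (s≤s (s≤s (s≤s ())))))
      far 2 4 1 refl (s≤s (s≤s (s≤s (s≤s (s≤s ())))))
      far 3 4 1 refl (s≤s (s≤s (s≤s (s≤s (s≤s ())))))
      far 4 4 1 refl (s≤s (s≤s (s≤s (s≤s (s≤s ())))))
      far i 5 0 refl i+5<5 = ⊥-elim (beyond {i = 5} (subst (_< 5) (+-comm i 5) i+5<5) ≤-refl)
      far i (suc (suc (suc (suc (suc (suc d)))))) e () _

  -- The top of the long cycle: the edge y x (h = 0), or a path y v x
  -- through an apex v of level M + 1 (h = 1).
  data Cap (a x y : V) (M : ℕ) : ℕ → Set where
    edge-cap : Adj y x → Cap a x y M 0
    apex-cap : (v : V) → Adj y v → Adj v x → Dist G a v (suc M) → Cap a x y M 1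

  module _ {a x y : V} {M : ℕ} where
    cap-apex : ∀ {h} → Cap a x y M h → V
    cap-apex (edge-cap _) = x
    cap-apex (apex-cap v _ _ _) = v

    cap-top : ∀ {h} (cap : Cap a x y M h) → (h ≡ 0 × Adj y x) ⊎ (h ≡ 1 × Adj (cap-apex cap) x)
    cap-top (edge-cap y~x) = inj₁ (refl , y~x)
    cap-top (apex-cap _ _ v~x _) = inj₂ (refl , v~x)

    cap-up : ∀ {h} (cap : Cap a x y M h) → h ≡ 1 → Adj y (cap-apex cap)
    cap-up (apex-cap _ y~v _ _) _ = y~v

    cap-level : ∀ {h} (cap : Cap a x y M h) → h ≡ 1 → Dist G a (cap-apex cap) (suc M)
    cap-level (apex-cap _ _ _ Dv) _ = Dv

    cap-≤1 : ∀ {h} → Cap a x y M h → h ≤ 1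
    cap-≤1 (edge-cap _) = z≤n
    cap-≤1 (apex-cap _ _ _ _) = ≤-refl

  -- The long cycle x = p 0, …, p M = a = q M, …, q 0 = y (, v) of length
  -- L = 2M + 1 + h, built from geodesics p and q and a cap.  All its pairs
  -- of positions except those between p i (i < M) and q j (j < M) are far
  -- enough apart by comparing levels; so if the cross pairs are far enough
  -- apart too, it is an isometric cycle, which is impossible.
  module LongCycle {a x y M h p q} (P : Geodesic a x M p) (Q : Geodesic a y M q) (cap : Cap a x y M h) where

    v : V
    v = cap-apex cap

    L : ℕ
    L = suc (M + M + h)

    c : ℕ → V
    c k with k ≤? M
    ... | yes _ = p k
    ... | no _ with k ≤? M + M
    ...   | yes _ = q ((M + M) ∸ k)
    ...   | no _ = v

    c-p : ∀ k → k ≤ M → c k ≡ p k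
    c-p k k≤M with k ≤? M
    ... | yes _ = refl
    ... | no k≰M = ⊥-elim (k≰M k≤M)

    c-q : ∀ k j → j < M → k + j ≡ M + M → c k ≡ q j
    c-q k j j<M k+j≡2M with k ≤? M
    ... | yes k≤M = ⊥-elim (<-irrefl k+j≡2M (<-≤-trans (+-monoʳ-< k j<M) (+-monoˡ-≤ M k≤M)))
    ... | no _ with k ≤? M + M
    ...   | yes _ = cong q (trans (cong (_∸ k) (sym k+j≡2M)) (m+n∸m≡n k j))
    ...   | no k≰2M = ⊥-elim (k≰2M (subst (k ≤_) k+j≡2M (m≤m+n k j)))

    c-apex : c (suc (M + M)) ≡ v
    c-apex with suc (M + M) ≤? M
    ... | yes 2M<M = ⊥-elim (<-irrefl refl (≤-trans (s≤s (m≤m+n M M)) 2M<M))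
    ... | no _ with suc (M + M) ≤? M + M
    ...   | yes 2M<2M = ⊥-elim (<-irrefl refl 2M<2M)
    ...   | no _ = refl

    data Position (k : ℕ) : Set where
      on-p : k ≤ M → Position k
      on-q : ∀ j → j < M → k + j ≡ M + M → Position k
      at-apex : h ≡ 1 → k ≡ suc (M + M) → Position k

    position : ∀ k → k < L → Position k
    position k k<L with k ≤? M
    ... | yes k≤M = on-p k≤M
    ... | no k≰M with k ≤? M + M
    ...   | yes k≤2M = on-q ((M + M) ∸ k) q-index (m+[n∸m]≡n k≤2M)
      where
      q-index : (M + M) ∸ k < M
      q-index = ≰⇒> λ M≤2M-k → <-irrefl refl (<-≤-trans (+-monoˡ-< M (≰⇒> k≰M))
                  (≤-trans (+-monoʳ-≤ k M≤2M-k) (≤-reflexive (m+[n∸m]≡n k≤2M))))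
    ...   | no k≰2M = apex (cap-≤1 cap) (≰⇒> k≰2M) k<L
      where
      apex : h ≤ 1 → M + M < k → k < suc (M + M + h) → Position k
      apex z≤n 2M<k k<L′ = ⊥-elim (<-irrefl refl (≤-trans 2M<k (≤-pred (subst (k <_) (cong suc (+-identityʳ (M + M))) k<L′))))
      apex (s≤s z≤n) 2M<k k<L′ =
        at-apex refl (≤-antisym (≤-pred (subst (k <_) (cong suc (+-comm (M + M) 1)) k<L′)) 2M<k)

    private
      open ≡-Reasoning

      -- Position k ≤ M holds p k of level M − k, position
      -- k ∈ (M, 2M] holds q (2M − k) of level k − M, and position 2M + 1 the
      -- apex of level M + 1.  For positions I < I + d the level difference is
      -- the forward distance d, except from p to the apex, where it is the
      -- backward distance e.
      gap-p-p : ∀ I d kI kJ → I + kI ≡ M → I + d + kJ ≡ M → kI ∸ kJ ≡ d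
      gap-p-p I d kI kJ I+kI≡M I+d+kJ≡M = trans (cong (_∸ kJ) kI≡d+kJ) (m+n∸n≡m d kJ)
        where
        kI≡d+kJ : kI ≡ d + kJ
        kI≡d+kJ = +-cancelˡ-≡ I kI (d + kJ) (trans I+kI≡M (trans (sym I+d+kJ≡M) (+-assoc I d kJ)))

      gap-a-q : ∀ d j kj → M + d + j ≡ M + M → j + kj ≡ M → kj ≡ d
      gap-a-q d j kj M+d+j≡2M j+kj≡M = +-cancelʳ-≡ (M + j) kj d (begin
        kj + (M + j)  ≡⟨ regroup₁ kj M j ⟩
        M + (j + kj)  ≡⟨ cong (M +_) j+kj≡M ⟩
        M + M         ≡⟨ sym M+d+j≡2M ⟩
        M + d + j     ≡⟨ regroup₂ M d j ⟩
        d + (M + j)   ∎)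
        where
        regroup₁ : ∀ kj M j → kj + (M + j) ≡ M + (j + kj)
        regroup₁ = solve-∀
        regroup₂ : ∀ M d j → M + d + j ≡ d + (M + j)
        regroup₂ = solve-∀

      gap-p-apex : ∀ I d e kI → d + e ≡ suc (M + M + 1) → I + d ≡ suc (M + M) → I + kI ≡ M → suc M ∸ kI ≡ e
      gap-p-apex I d e kI d+e≡L I+d≡2M+1 I+kI≡M = ∸-from-+ (+-cancelʳ-≡ (I + d) (e + kI) (suc M) (begin
        e + kI + (I + d)       ≡⟨ regroup₁ e kI I d ⟩
        (d + e) + (I + kI)     ≡⟨ cong₂ _+_ d+e≡L I+kI≡M ⟩
        suc (M + M + 1) + M    ≡⟨ regroup₂ M ⟩
        suc M + suc (M + M)    ≡⟨ cong (suc M +_) (sym I+d≡2M+1) ⟩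
        suc M + (I + d)        ∎))
        where
        regroup₁ : ∀ e kI I d → e + kI + (I + d) ≡ (d + e) + (I + kI)
        regroup₁ = solve-∀
        regroup₂ : ∀ M → suc (M + M + 1) + M ≡ suc M + suc (M + M)
        regroup₂ = solve-∀

      gap-q-q : ∀ I d i j ki kj → I + i ≡ M + M → I + d + j ≡ M + M → i + ki ≡ M → j + kj ≡ M → kj ∸ ki ≡ d
      gap-q-q I d i j ki kj I+i≡2M I+d+j≡2M i+ki≡M j+kj≡M = ∸-from-+ (sym (+-cancelʳ-≡ (j + (I + i)) kj (d + ki) (begin
        kj + (j + (I + i))        ≡⟨ regroup₁ kj j I i ⟩
        (j + kj) + (I + i)        ≡⟨ cong₂ _+_ j+kj≡M I+i≡2M ⟩
        M + (M + M)               ≡⟨ +-comm M (M + M) ⟩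
        (M + M) + M               ≡⟨ cong₂ _+_ (sym I+d+j≡2M) (sym i+ki≡M) ⟩
        (I + d + j) + (i + ki)    ≡⟨ regroup₂ I d j i ki ⟩
        (d + ki) + (j + (I + i))  ∎)))
        where
        regroup₁ : ∀ kj j I i → kj + (j + (I + i)) ≡ (j + kj) + (I + i)
        regroup₁ = solve-∀
        regroup₂ : ∀ I d j i ki → (I + d + j) + (i + ki) ≡ (d + ki) + (j + (I + i))
        regroup₂ = solve-∀

      gap-q-apex : ∀ I d i ki → I + d ≡ suc (M + M) → I + i ≡ M + M → i + ki ≡ M → suc M ∸ ki ≡ d
      gap-q-apex I d i ki I+d≡2M+1 I+i≡2M i+ki≡M = ∸-from-+ (+-cancelʳ-≡ (I + i) (d + ki) (suc M) (begin
        d + ki + (I + i)       ≡⟨ regroup₁ d ki I i ⟩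
        (I + d) + (i + ki)     ≡⟨ cong₂ _+_ I+d≡2M+1 i+ki≡M ⟩
        suc (M + M) + M        ≡⟨ regroup₂ M ⟩
        suc M + (M + M)        ≡⟨ cong (suc M +_) (sym I+i≡2M) ⟩
        suc M + (I + i)        ∎))
        where
        regroup₁ : ∀ d ki I i → d + ki + (I + i) ≡ (I + d) + (i + ki)
        regroup₁ = solve-∀
        regroup₂ : ∀ M → suc (M + M) + M ≡ suc M + (M + M)
        regroup₂ = solve-∀

      q-before-p : ∀ I i d → I + i ≡ M + M → i < M → I + suc d ≤ M → ⊥
      q-before-p I i d I+i≡2M i<M I+d<M =
        <-irrefl I+i≡2M (≤-<-trans (+-monoˡ-≤ i (≤-trans (m≤m+n I (suc d)) I+d<M)) (+-monoʳ-< M i<M))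

      apex-last : ∀ I d → I ≡ suc (M + M) → I + suc d < L → ⊥
      apex-last I d refl I+d<L = <-irrefl refl (≤-trans (+-monoʳ-≤ (suc (M + M)) (s≤s (z≤n {d})))
                                   (≤-trans (≤-pred I+d<L) (+-monoʳ-≤ (M + M) (cap-≤1 cap))))

    level-p : ∀ k → k ≤ M → Dist G a (p k) (M ∸ k)
    level-p k k≤M = Geodesic.level P k (M ∸ k) (m+[n∸m]≡n k≤M)

    level-q : ∀ j → j < M → Dist G a (q j) (M ∸ j)
    level-q j j<M = Geodesic.level Q j (M ∸ j) (m+[n∸m]≡n (<⇒≤ j<M))

    CrossBound : Set
    CrossBound = ∀ i j d e → i < M → j < M → i + d + j ≡ M + M → d + e ≡ L → LB (p i) (q j) (d ⊓ e)

    far : CrossBound → ∀ I d e → d + e ≡ L → I + d < L → LB (c I) (c (I + d)) (d ⊓ e)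
    far _ I zero e _ _ = LB-0
    far cross I (suc d) e d+e≡L I+d<L = by-position (position I (≤-<-trans (m≤m+n I (suc d)) I+d<L)) (position J I+d<L)
      where
      J : ℕ
      J = I + suc d
      at : ∀ {u w t} → c I ≡ u → c J ≡ w → LB u w t → LB (c I) (c J) t
      at refl refl lb = lb
      by-position : Position I → Position J → LB (c I) (c J) (suc d ⊓ e)
      by-position (on-p I≤M) (on-p J≤M) = at (c-p I I≤M) (c-p J J≤M) (LB-mono (m⊓n≤m (suc d) e)
        (LB-cast (level-gap (level-p I I≤M) (level-p J J≤M))
                 (gap-p-p I (suc d) (M ∸ I) (M ∸ J) (m+[n∸m]≡n I≤M) (m+[n∸m]≡n J≤M))))
      by-position (on-p I≤M) (on-q j j<M J+j≡2M) with m≤n⇒m<n∨m≡n I≤M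
      ... | inj₁ I<M = at (c-p I I≤M) (c-q J j j<M J+j≡2M) (cross I j (suc d) e I<M j<M J+j≡2M d+e≡L)
      ... | inj₂ refl = at (c-p I I≤M) (c-q J j j<M J+j≡2M) (LB-mono (m⊓n≤m (suc d) e)
        (LB-cast (level-gap′ (Geodesic.level P I 0 (+-identityʳ I)) (level-q j j<M))
                 (gap-a-q (suc d) j (I ∸ j) J+j≡2M (m+[n∸m]≡n (<⇒≤ j<M)))))
      by-position (on-p I≤M) (at-apex h≡1 J≡2M+1) = at (c-p I I≤M) (trans (cong c J≡2M+1) c-apex)
        (LB-mono (m⊓n≤n (suc d) e) (LB-cast (level-gap′ (level-p I I≤M) (cap-level cap h≡1))
          (gap-p-apex I (suc d) e (M ∸ I) (subst (λ h → suc d + e ≡ suc (M + M + h)) h≡1 d+e≡L) J≡2M+1 (m+[n∸m]≡n I≤M))))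
      by-position (on-q i i<M I+i≡2M) (on-p J≤M) = ⊥-elim (q-before-p I i d I+i≡2M i<M J≤M)
      by-position (on-q i i<M I+i≡2M) (on-q j j<M J+j≡2M) = at (c-q I i i<M I+i≡2M) (c-q J j j<M J+j≡2M)
        (LB-mono (m⊓n≤m (suc d) e) (LB-cast (level-gap′ (level-q i i<M) (level-q j j<M))
          (gap-q-q I (suc d) i j (M ∸ i) (M ∸ j) I+i≡2M J+j≡2M (m+[n∸m]≡n (<⇒≤ i<M)) (m+[n∸m]≡n (<⇒≤ j<M)))))
      by-position (on-q i i<M I+i≡2M) (at-apex h≡1 J≡2M+1) = at (c-q I i i<M I+i≡2M) (trans (cong c J≡2M+1) c-apex)
        (LB-mono (m⊓n≤m (suc d) e) (LB-cast (level-gap′ (level-q i i<M) (cap-level cap h≡1))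
          (gap-q-apex I (suc d) i (M ∸ i) J≡2M+1 I+i≡2M (m+[n∸m]≡n (<⇒≤ i<M)))))
      by-position (at-apex _ I≡2M+1) _ = ⊥-elim (apex-last I d I≡2M+1 I+d<L)

    adjacent : 1 ≤ M → ∀ k → suc k < L → Adj (c k) (c (suc k))
    adjacent 1≤M k k+1<L = by-position (position k (<-trans (n<1+n k) k+1<L))
      where
      by-position : Position k → Adj (c k) (c (suc k))
      by-position (on-p k≤M) with m≤n⇒m<n∨m≡n k≤M
      ... | inj₁ k<M = subst₂ Adj (sym (c-p k k≤M)) (sym (c-p (suc k) k<M)) (Geodesic.adjacent P k k<M)
      ... | inj₂ refl = subst₂ Adj (sym (trans (c-p k k≤M) (end P))) (sym (c-q (suc k) j j<k k+1+j≡2M))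
                          (Adj-sym (subst (Adj (q j)) (trans (cong q j+1≡k) (end Q)) (Geodesic.adjacent Q j j<k)))
        where
        j : ℕ
        j = k ∸ 1
        j+1≡k : suc j ≡ k
        j+1≡k = m+[n∸m]≡n 1≤M
        j<k : j < k
        j<k = ≤-reflexive j+1≡k
        k+1+j≡2M : suc k + j ≡ k + k
        k+1+j≡2M = trans (sym (+-suc k j)) (cong (k +_) j+1≡k)
      by-position (on-q zero 0<M k+0≡2M) with cap-top cap
      ... | inj₁ (refl , _) = ⊥-elim (<-irrefl refl (≤-trans k+1<L (≤-reflexive (cong suc k≡2M+h))))
        where
        k≡2M+h : M + M + 0 ≡ k
        k≡2M+h = trans (+-identityʳ (M + M)) (trans (sym k+0≡2M) (+-identityʳ k))
      ... | inj₂ (h≡1 , _) = subst₂ Adj (sym (trans (c-q k 0 0<M k+0≡2M) (Geodesic.start Q)))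
                               (sym (trans (cong (λ z → c (suc z)) (trans (sym (+-identityʳ k)) k+0≡2M)) c-apex))
                               (cap-up cap h≡1)
      by-position (on-q (suc j) j+1<M k+j+1≡2M) =
        subst₂ Adj (sym (c-q k (suc j) j+1<M k+j+1≡2M)) (sym (c-q (suc k) j (<-trans (n<1+n j) j+1<M) (trans (sym (+-suc k j)) k+j+1≡2M)))
          (Adj-sym (Geodesic.adjacent Q j (<⇒≤ j+1<M)))
      by-position (at-apex _ k≡2M+1) = ⊥-elim (apex-last k 0 k≡2M+1 (subst (_< L) (+-comm 1 k) k+1<L))

    closing : 1 ≤ M → Adj (c (M + M + h)) (c 0)
    closing 1≤M with cap-top cap
    ... | inj₁ (refl , y~x) = subst₂ Adj (sym (trans (c-q (M + M + 0) 0 1≤M (trans (+-identityʳ _) (+-identityʳ (M + M)))) (Geodesic.start Q)))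
                                (sym (trans (c-p 0 z≤n) (Geodesic.start P))) y~x
    ... | inj₂ (refl , v~x) = subst₂ Adj (sym (trans (cong c (+-comm (M + M) 1)) c-apex))
                                (sym (trans (c-p 0 z≤n) (Geodesic.start P))) v~x

    contradiction : Bridged G → 1 ≤ M → 3 ≤ M + M + h → CrossBound → ⊥
    contradiction bridged 1≤M 3≤L′ cross =
      no-isometric-cycle bridged (M + M + h) 3≤L′ c (adjacent 1≤M) (closing 1≤M) (far cross)

  -- Let p, q be geodesics from
  -- x and y down to a, and b = p i with i < M.  In the long cycle of
  -- LongCycle the positions of b and of q j are d apart forward
  -- (through a) and e apart backward (through the top), d + e = 2M + 1 + h.
  cross-bound : ∀ {a y M b q} → Geodesic a y M q → ∀ i h → i < M →
    (∀ j → i + j < M → LB b (q j) (suc (j + (h + i)))) → LB b (q (M ∸ i)) M →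
    ∀ j d e → j < M → i + d + j ≡ M + M → d + e ≡ suc (M + M + h) → LB b (q j) (d ⊓ e)
  cross-bound {M = M} {b} {q} Q i h i<M ascent anchor j d e j<M i+d+j≡2M d+e≡L with (i + j) <? M
  ... | yes i+j<M = LB-mono (m⊓n≤n d e) (LB-cast (ascent j i+j<M) (sym backward))
    where
    open ≡-Reasoning
    backward : e ≡ suc (j + (h + i))
    backward = +-cancelʳ-≡ (M + M) e (suc (j + (h + i))) (begin
      e + (M + M)                 ≡⟨ cong (e +_) (sym i+d+j≡2M) ⟩
      e + (i + d + j)             ≡⟨ regroup₁ e i d j ⟩
      (d + e) + (i + j)           ≡⟨ cong (_+ (i + j)) d+e≡L ⟩
      suc (M + M + h) + (i + j)   ≡⟨ regroup₂ M h i j ⟩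
      suc (j + (h + i)) + (M + M) ∎)
      where
      regroup₁ : ∀ e i d j → e + (i + d + j) ≡ (d + e) + (i + j)
      regroup₁ = solve-∀
      regroup₂ : ∀ M h i j → suc (M + M + h) + (i + j) ≡ suc (j + (h + i)) + (M + M)
      regroup₂ = solve-∀
  ... | no i+j≮M = LB-mono (m⊓n≤m d e)
        (LB-cast (subst (λ z → LB b (q z) (M ∸ s)) (sym j≡A+s) (LB-down Q anchor s (subst (_≤ M) j≡A+s (<⇒≤ j<M))))
                 forward)
    where
    open ≡-Reasoning
    A : ℕ
    A = M ∸ i
    A≤j : A ≤ j
    A≤j = m≤n+o⇒m∸n≤o M i (≮⇒≥ i+j≮M)
    s : ℕ
    s = j ∸ A
    j≡A+s : j ≡ A + s
    j≡A+s = sym (m+[n∸m]≡n A≤j)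
    forward : M ∸ s ≡ d
    forward = ∸-from-+ (+-cancelʳ-≡ M (d + s) M (begin
      d + s + M           ≡⟨ cong (d + s +_) (sym (m∸n+n≡m (<⇒≤ i<M))) ⟩
      d + s + (A + i)     ≡⟨ regroup d s A i ⟩
      i + d + (A + s)     ≡⟨ cong (i + d +_) (sym j≡A+s) ⟩
      i + d + j           ≡⟨ i+d+j≡2M ⟩
      M + M               ∎))
      where
      regroup : ∀ d s A i → d + s + (A + i) ≡ i + d + (A + s)
      regroup = solve-∀

  TC : ℕ → Set
  TC m = ∀ a x y → Dist G a x (suc m) → Dist G a y (suc m) → Adj x y →
         ¬ ¬ Σ V λ w → Adj w x × Adj w y × Dist G a w m

  SC : ℕ → Set
  SC m = ∀ a v p q → Dist G a v (suc m) → Dist G a p m → Dist G a q m →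
         Adj v p → Adj v q → ¬ (p ≡ q) → ¬ Adj p q → ⊥

  module _ (conn : Connected G) where

    module Ascent (a b z y : V) (M i h : ℕ)
      (tc : ∀ j → i + suc j < M → TC (j + (h + i)))
      (sc : ∀ j → i + suc j < M → SC (j + (h + i)))
      (Dz : Dist G b z (h + i))
      (z~y : Adj z y)
      (Lz : Dist G a z (h + M))
      (z-far : ∀ w k → suc k ≡ M → Adj w y → Dist G a w k → ¬ Adj z w)
      (top-plateau : ∀ q → Geodesic a y M q → ∀ w → Adj z w → Adj w y → Adj w (q 1) →
                     Dist G b w (h + i) → Dist G b (q 1) (suc (h + i)) → ⊥) where

      B : ℕ
      B = h + i

      Ascending : (ℕ → V) → ℕ → Set
      Ascending q j = ∀ l → l ≤ j → Dist G b (q l) (suc (l + B))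

      before : (ℕ → V) → ℕ → V
      before q zero = z
      before q (suc j) = q j

      before-dist : ∀ q j → Ascending q j → Dist G b (before q j) (j + B)
      before-dist q zero _ = Dz
      before-dist q (suc j) A = A j (n≤1+n j)

      before-adj : ∀ q → Geodesic a y M q → ∀ j → j ≤ M → Adj (before q j) (q j)
      before-adj q Q zero _ = subst (Adj z) (sym (Geodesic.start Q)) z~y
      before-adj q Q (suc j) j<M = Geodesic.adjacent Q j j<M

      -- before q j and q (j+1) are two apart on the path, and their levels show
      -- they are neither equal nor adjacent.
      before-far : ∀ q → Geodesic a y M q → ∀ j → suc j ≤ M →
        ¬ (before q j ≡ q (suc j)) × ¬ Adj (before q j) (q (suc j))
      before-far q Q zero 1≤M =
        level-≢ Lz L₁ h+M≢M-1 , z-far (q 1) (M ∸ 1) M-1+1≡M (Adj-sym y~q₁) L₁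
        where
        open Geodesic Q
        M-1+1≡M : suc (M ∸ 1) ≡ M
        M-1+1≡M = m+[n∸m]≡n 1≤M
        L₁ : Dist G a (q 1) (M ∸ 1)
        L₁ = level 1 (M ∸ 1) M-1+1≡M
        y~q₁ : Adj y (q 1)
        y~q₁ = subst (λ u → Adj u (q 1)) start (adjacent 0 1≤M)
        h+M≢M-1 : ¬ (h + M ≡ M ∸ 1)
        h+M≢M-1 eq = <-irrefl refl (≤-trans (s≤s (≤-trans (m≤n+m M h) (≤-reflexive eq))) (≤-reflexive M-1+1≡M))
      before-far q Q (suc j) j+2≤M = level-≢ L₀ L₂ (λ eq → <-irrefl (sym eq) (n≤1+n (suc k))) , level-¬Adj L₀ L₂ ≤-refl
        where
        open Geodesic Q
        k : ℕ
        k = M ∸ suc (suc j)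
        j+2+k≡M : suc (suc j) + k ≡ M
        j+2+k≡M = m+[n∸m]≡n j+2≤M
        L₂ : Dist G a (q (suc (suc j))) k
        L₂ = level (suc (suc j)) k j+2+k≡M
        shift : ∀ j k → j + suc (suc k) ≡ suc (suc j) + k
        shift = solve-∀
        L₀ : Dist G a (q j) (suc (suc k))
        L₀ = level j (suc (suc k)) (trans (shift j k) j+2+k≡M)

      -- The distance from b cannot drop back at step j+1 (by SC at level j + B).
      no-descent : ∀ q → Geodesic a y M q → ∀ j → suc j ≤ M → Ascending q j → SC (j + B) →
        Dist G b (q (suc j)) (j + B) → ⊥
      no-descent q Q j j<M A sc′ D =
        sc′ b (q j) (before q j) (q (suc j)) (A j ≤-refl) (before-dist q j A) D
          (Adj-sym (before-adj q Q j (≤-trans (n≤1+n j) j<M))) (Geodesic.adjacent Q j j<M)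
          (proj₁ (before-far q Q j j<M)) (proj₂ (before-far q Q j j<M))

      private
        fits : ∀ {j} → i + j < M → suc j ≤ M
        fits {j} i+j<M = ≤-trans (s≤s (m≤n+m j i)) i+j<M

        fits-pred : ∀ {j} → i + suc j < M → i + j < M
        fits-pred {j} i+j+1<M = <-trans (+-monoʳ-< i (n<1+n j)) i+j+1<M

      -- The distance from b cannot stay constant at step j+1.  TC gives a common
      -- neighbour w of q j and q (j+1) one step closer to b; by SC w is adjacent
      -- to before q j, and replacing q j by w yields a geodesic that is flat one
      -- step earlier.  At the first step this is excluded by top-plateau.
      no-plateau : ∀ j q → Geodesic a y M q → Ascending q j → i + suc j < M →
        Dist G b (q (suc j)) (suc (j + B)) → ⊥
      no-plateau j q Q A i+j+1<M D = tc j i+j+1<M b (q j) (q (suc j)) (A j ≤-refl) D (Geodesic.adjacent Q j j+1≤M)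
        λ (w , w~qj , w~qj+1 , Dw) →
          sc j i+j+1<M b (q j) (before q j) w (A j ≤-refl) (before-dist q j A) Dw
            (Adj-sym (before-adj q Q j (≤-trans (n≤1+n j) j+1≤M))) (Adj-sym w~qj)
            (λ eq → proj₂ (before-far q Q j j+1≤M) (subst (λ u → Adj u (q (suc j))) (sym eq) w~qj+1))
            (shortcut j q Q A i+j+1<M D w w~qj w~qj+1 Dw)
        where
        j+1≤M : suc j ≤ M
        j+1≤M = ≤-trans (n≤1+n (suc j)) (fits i+j+1<M)
        shortcut : ∀ j q → Geodesic a y M q → Ascending q j → i + suc j < M →
          Dist G b (q (suc j)) (suc (j + B)) →
          ∀ w → Adj w (q j) → Adj w (q (suc j)) → Dist G b w (j + B) → ¬ Adj (before q j) w
        shortcut zero q Q _ _ D w w~q₀ w~q₁ Dw z~w =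
          top-plateau q Q w z~w (subst (Adj w) (Geodesic.start Q) w~q₀) w~q₁ Dw D
        shortcut (suc j) q Q A i+j+2<M _ w _ w~qj+2 Dw qj~w = withDist conn a w λ (_ , Lw) →
          no-plateau j q′ (replace-geodesic Q j (fits (fits-pred i+j+2<M)) qj~w w~qj+2 Lw) A′ (fits-pred i+j+2<M) Dq′
          where
          q′ : ℕ → V
          q′ = replaceAt q (suc j) w
          A′ : Ascending q′ j
          A′ l l≤j = subst (λ u → Dist G b u (suc (l + B)))
            (sym (replaceAt-≢ q (suc j) w l (λ { refl → <-irrefl refl l≤j })))
            (A l (≤-trans l≤j (n≤1+n j)))
          Dq′ : Dist G b (q′ (suc j)) (suc (j + B))
          Dq′ = subst (λ u → Dist G b u (suc (j + B))) (sym (replaceAt-≡ q (suc j) w)) Dw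

      ascending : ¬ ¬ Dist G b y (suc B) → ∀ q → Geodesic a y M q → ∀ j → i + j < M → ¬ ¬ Ascending q j
      ascending ¬¬Dy q Q zero _ ¬A = ¬¬Dy λ Dy → ¬A λ
        { zero _ → subst (λ u → Dist G b u (suc B)) (sym (Geodesic.start Q)) Dy }
      ascending ¬¬Dy q Q (suc j) i+j+1<M ¬A = ascending ¬¬Dy q Q j (fits-pred i+j+1<M) λ A →
        withDist conn b (q (suc j)) λ (D , DD) →
          let qj~qj+1 = Geodesic.adjacent Q j (fits (fits-pred i+j+1<M))
          in next A D DD (between-t-and-t+2 (≤-pred (level-adj (Adj-sym qj~qj+1) DD (A j ≤-refl)))
                                            (level-adj qj~qj+1 (A j ≤-refl) DD))
        where
        next : Ascending q j → ∀ D → Dist G b (q (suc j)) D →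
          (D ≡ j + B) ⊎ ((D ≡ suc (j + B)) ⊎ (D ≡ suc (suc (j + B)))) → ⊥
        next A D DD (inj₁ refl) = no-descent q Q j (fits (fits-pred i+j+1<M)) A (sc j i+j+1<M) DD
        next A D DD (inj₂ (inj₁ refl)) = no-plateau j q Q A i+j+1<M DD
        next A D DD (inj₂ (inj₂ refl)) = ¬A λ l l≤j+1 → extend l (m≤n⇒m<n∨m≡n l≤j+1)
          where
          extend : ∀ l → l < suc j ⊎ l ≡ suc j → Dist G b (q l) (suc (l + B))
          extend l (inj₁ l≤j) = A l (≤-pred l≤j)
          extend l (inj₂ refl) = DD

      ascent : ¬ ¬ Dist G b y (suc B) → ∀ q → Geodesic a y M q → ∀ j → i + j < M → LB b (q j) (suc (j + B))
      ascent ¬¬Dy q Q j i+j<M = LB-stable λ ¬lb → ascending ¬¬Dy q Q j i+j<M λ A → ¬lb (proj₂ (A j ≤-refl))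

  module _ (conn : Connected G) (bridged : Bridged G) where

    private
      attained? : ∀ {t D} → t ≤ D → t < D ⊎ t ≡ D
      attained? = m≤n⇒m<n∨m≡n

    -- We bound the cross pairs of the long cycle closed by the
    -- edge x y, using the ascent lemma with base vertices b = p i.
    module TriangleStep (m : ℕ) (tc< : ∀ t → t < suc m → TC t) (sc≤ : ∀ t → t ≤ suc m → SC t)
      (a x y : V) (Dx : Dist G a x (suc (suc m))) (Dy : Dist G a y (suc (suc m))) (x~y : Adj x y)
      (¬w : ¬ Σ V λ w → Adj w x × Adj w y × Dist G a w (suc m))
      {p q : ℕ → V} (P : Geodesic a x (suc (suc m)) p) (Q : Geodesic a y (suc (suc m)) q) where

      M : ℕ
      M = suc (suc m)

      module Base (i : ℕ) (i<M : i < M) where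
        b : V
        b = p i
        kb : ℕ
        kb = M ∸ i

        i+kb≡M : i + kb ≡ M
        i+kb≡M = m+[n∸m]≡n (<⇒≤ i<M)

        Lb : Dist G a b kb
        Lb = Geodesic.level P i kb i+kb≡M

        Dbx : Dist G b x i
        Dbx = dist-from-start P i (<⇒≤ i<M)

        b-lower : ∀ {u} → Dist G a u M → LB b u i
        b-lower Du = LB-cast (level-gap′ Lb Du) (m∸[m∸n]≡n (<⇒≤ i<M))

        level-pinned : ∀ {c n} → suc n + kb ≡ M → Adj c x → Dist G b c n → ¬ ¬ Dist G a c (suc m)
        level-pinned {c} {n} n+1+kb≡M c~x Dc ¬Lc = withDist conn a c λ (D , DD) → ¬Lc (Dist-cast DD
          (≤-pred (level-adj c~x DD Dx))
          (subst (D ≤_) (trans (+-comm kb n) (suc-injective n+1+kb≡M)) (proj₂ DD _ (proj₁ Lb ++ʷ proj₁ Dc))))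

        -- Two adjacent vertices x, w at the same distance n from b (n + kb = M)
        -- have a common neighbour of level m + 1: for n = 0 they would coincide,
        -- otherwise apply TC at level n − 1 around b.
        common-below : ∀ {w} n → n + kb ≡ M → Dist G b x n → Dist G b w n → Adj x w →
          ¬ ¬ Σ V λ c → Adj c x × Adj c w × Dist G a c (suc m)
        common-below zero _ D0 Dw0 x~w _ = irrefl (subst (Adj x) (trans (sym (Dist0⇒≡ Dw0)) (Dist0⇒≡ D0)) x~w)
        common-below (suc n) n+1+kb≡M Dn Dwn x~w ¬c = tc< n n<m+1 b x _ Dn Dwn x~w λ (c , c~x , c~w , Dc) →
          level-pinned n+1+kb≡M c~x Dc λ Lc → ¬c (c , c~x , c~w , Lc)
          where
          n<m+1 : n < suc m
          n<m+1 = s≤s (≤-pred (≤-pred (≤-trans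
            (subst (_≤ suc n + kb) (+-comm (suc n) 1) (+-monoʳ-≤ (suc n) (m<n⇒0<n∸m i<M)))
            (≤-reflexive n+1+kb≡M))))

        -- y is one step farther from b than x: at distance i, common-below would
        -- give a common neighbour of x and y of level m + 1.
        Dby : ¬ ¬ Dist G b y (suc i)
        Dby ¬Dby = withDist conn b y λ (D , DD) →
          by-cases D DD (m≤n⇒m<n∨m≡n (subst (D ≤_) (+-comm i 1) (proj₂ DD _ (proj₁ Dbx ++ʷ edgeʷ x~y))))
          where
          by-cases : ∀ D → Dist G b y D → D < suc i ⊎ D ≡ suc i → ⊥
          by-cases D DD (inj₂ refl) = ¬Dby DD
          by-cases D DD (inj₁ D≤i) = common-below i i+kb≡M Dbx
            (Dist-cast DD (b-lower Dy D (proj₁ DD)) (≤-pred D≤i)) x~y ¬w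

        x-far : ∀ w k → suc k ≡ M → Adj w y → Dist G a w k → ¬ Adj x w
        x-far w k k+1≡M w~y Dw x~w = ¬w (w , Adj-sym x~w , w~y , subst (Dist G a w) (suc-injective k+1≡M) Dw)

        -- A common neighbour w of x, y and q′ 1 at distance i from b: its level is
        -- m + 1 (excluded by ¬w) or M; in the latter case common-below gives a
        -- vertex c of level m + 1 adjacent to x and w, and SC around w forces
        -- an induced 4-cycle x c (q′ 1) y.
        top-plateau : ∀ q′ → Geodesic a y M q′ → ∀ w → Adj x w → Adj w y → Adj w (q′ 1) →
          Dist G b w (0 + i) → Dist G b (q′ 1) (suc (0 + i)) → ⊥
        top-plateau q′ Q′ w x~w w~y w~q₁ Dw _ = withDist conn a w λ (D , DD) →
          by-level D DD (attained? (level-adj (Adj-sym w~q₁) Lq₁ DD)) (≤-pred (level-adj w~y DD Dy))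
          where
          Lq₁ : Dist G a (q′ 1) (suc m)
          Lq₁ = Geodesic.level Q′ 1 (suc m) refl
          q₁~y : Adj (q′ 1) y
          q₁~y = Adj-sym (subst (λ u → Adj u (q′ 1)) (Geodesic.start Q′) (Geodesic.adjacent Q′ 0 (s≤s z≤n)))
          by-level : ∀ D → Dist G a w D → D < M ⊎ D ≡ M → suc m ≤ D → ⊥
          by-level D DD (inj₁ D<M) m+1≤D = ¬w (w , Adj-sym x~w , w~y , Dist-cast DD m+1≤D (≤-pred D<M))
          by-level D DD (inj₂ refl) _ = common-below i i+kb≡M Dbx Dw x~w λ (c , c~x , c~w , Lc) →
            sc≤ (suc m) ≤-refl a w c (q′ 1) DD Lc Lq₁ (Adj-sym c~w) w~q₁
              (λ { refl → ¬w (q′ 1 , c~x , q₁~y , Lq₁) })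
              (λ c~q₁ → no-induced-C4 bridged (Adj-sym c~x) c~q₁ q₁~y (Adj-sym x~y)
                 (level-≢ Dx Lq₁ (λ eq → <-irrefl (sym eq) ≤-refl)) (λ x~q₁ → ¬w (q′ 1 , Adj-sym x~q₁ , q₁~y , Lq₁))
                 (level-≢ Lc Dy (λ eq → <-irrefl eq ≤-refl)) (λ c~y → ¬w (c , c~x , c~y , Lc)))

        open Ascent conn a b x y M i 0
          (λ j i+j+1<M → tc< (j + i) (subst (_≤ suc m) (trans (+-suc i j) (cong suc (+-comm i j))) (≤-pred i+j+1<M)))
          (λ j i+j+1<M → sc≤ (j + i) (≤-trans (≤-reflexive (+-comm j i))
                                       (≤-trans (n≤1+n (i + j)) (subst (_≤ suc m) (+-suc i j) (≤-pred i+j+1<M)))))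
          Dbx x~y Dx x-far top-plateau

        -- After M − i − 1 ascending steps the distance from b has reached M − 1,
        -- and one more step cannot descend (SC at level m + 1), so it reaches M.
        anchor : LB b (q (M ∸ i)) M
        anchor = LB-stable λ ¬anchor → ascending Dby q Q j (≤-reflexive (m+[n∸m]≡n i<M)) λ A →
          withDist conn b (q (suc j)) λ (D , DD) →
            by-cases ¬anchor A D DD (attained? (≤-pred (level-adj (Adj-sym (Geodesic.adjacent Q j j+1≤M)) DD (A j ≤-refl))))
          where
          j : ℕ
          j = M ∸ suc i
          j+1≡M-i : suc j ≡ M ∸ i
          j+1≡M-i = sym (+-∸-assoc 1 i<M)
          j+1≤M : suc j ≤ M
          j+1≤M = subst (_≤ M) (sym j+1≡M-i) (m∸n≤m M i)
          j+i+1≡M : suc (j + i) ≡ M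
          j+i+1≡M = trans (cong suc (+-comm j i)) (m+[n∸m]≡n i<M)
          by-cases : ¬ LB b (q (M ∸ i)) M → Ascending q j → ∀ D → Dist G b (q (suc j)) D → j + i < D ⊎ j + i ≡ D → ⊥
          by-cases ¬anchor A D DD (inj₁ j+i<D) = ¬anchor (subst (λ z → LB b (q z) M) j+1≡M-i
            (λ ℓ w → ≤-trans (subst (_≤ D) j+i+1≡M j+i<D) (proj₂ DD ℓ w)))
          by-cases _ A D DD (inj₂ refl) = no-descent q Q j j+1≤M A (sc≤ (j + i) (≤-pred (≤-reflexive j+i+1≡M))) DD

        cross : ∀ j d e → j < M → i + d + j ≡ M + M → d + e ≡ suc (M + M + 0) → LB b (q j) (d ⊓ e)
        cross = cross-bound Q i 0 i<M (ascent Dby q Q) anchor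

      contradiction : ⊥
      contradiction = LongCycle.contradiction P Q (edge-cap (Adj-sym x~y)) bridged (s≤s z≤n) 3≤2M
        λ i j d e i<M → Base.cross i i<M j d e
        where
        3≤2M : 3 ≤ M + M + 0
        3≤2M = +-monoˡ-≤ 0 (+-mono-≤ (s≤s (s≤s z≤n)) (s≤s z≤n))

    -- We bound
    -- the cross pairs of the long cycle closed by the path x v y.
    module SquareStep (m : ℕ) (tc< : ∀ t → t < suc m → TC t) (sc< : ∀ t → t < suc m → SC t)
      (a v x y : V) (Dv : Dist G a v (suc (suc m))) (Dx : Dist G a x (suc m)) (Dy : Dist G a y (suc m))
      (v~x : Adj v x) (v~y : Adj v y) (x≢y : ¬ (x ≡ y)) (x≁y : ¬ Adj x y)
      {p q : ℕ → V} (P : Geodesic a x (suc m) p) (Q : Geodesic a y (suc m) q) where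

      M : ℕ
      M = suc m

      -- If y′ is, like y, a neighbour of v of level M distinct from and not
      -- adjacent to x, then x and y′ have no common neighbour w of level M:
      -- TC below the edges w y′ and x w and SC around w would produce an
      -- induced 4- or 5-cycle through v.
      no-common-neighbour : ∀ {y′ w} → Dist G a y′ M → Adj v y′ → ¬ (x ≡ y′) → ¬ Adj x y′ →
        Dist G a w M → Adj w x → Adj w y′ → ⊥
      no-common-neighbour {y′} {w} Dy′ v~y′ x≢y′ x≁y′ Dw w~x w~y′ =
        tc< m ≤-refl a w y′ Dw Dy′ w~y′ λ (c₁ , c₁~w , c₁~y′ , Dc₁) →
        tc< m ≤-refl a x w Dx Dw (Adj-sym w~x) λ (c₂ , c₂~x , c₂~w , Dc₂) →
        sc< m ≤-refl a w c₁ c₂ Dw Dc₁ Dc₂ (Adj-sym c₁~w) (Adj-sym c₂~w)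
          (λ { refl → square c₁ (Adj-sym c₂~x) c₁~y′ Dc₁ })
          (λ c₁~c₂ → ¬¬-excluded-middle {A = Adj x c₁} λ
             { (yes x~c₁) → square c₁ x~c₁ c₁~y′ Dc₁
             ; (no x≁c₁) → ¬¬-excluded-middle {A = Adj y′ c₂} λ
               { (yes y′~c₂) → square c₂ (Adj-sym c₂~x) (Adj-sym y′~c₂) Dc₂
               ; (no y′≁c₂) → no-induced-C5 bridged v~x (Adj-sym c₂~x) (Adj-sym c₁~c₂) c₁~y′ (Adj-sym v~y′)
                   (v≢ Dc₂) (v≁ Dc₂) (v≢ Dc₁) (v≁ Dc₁)
                   (level-≢ Dx Dc₁ (λ eq → <-irrefl (sym eq) ≤-refl)) x≁c₁
                   x≢y′ x≁y′
                   (level-≢ Dc₂ Dy′ (λ eq → <-irrefl eq ≤-refl)) (λ c₂~y′ → y′≁c₂ (Adj-sym c₂~y′)) } })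
        where
        v≢ : ∀ {c} → Dist G a c m → ¬ (v ≡ c)
        v≢ Dc = level-≢ Dv Dc (λ eq → <-irrefl (sym eq) (n≤1+n (suc m)))
        v≁ : ∀ {c} → Dist G a c m → ¬ Adj v c
        v≁ Dc = level-¬Adj Dv Dc ≤-refl
        square : ∀ c → Adj x c → Adj c y′ → Dist G a c m → ⊥
        square c x~c c~y′ Dc = no-induced-C4 bridged v~x x~c c~y′ (Adj-sym v~y′) (v≢ Dc) (v≁ Dc) x≢y′ x≁y′

      module Base (i : ℕ) (i<M : i < M) where
        b : V
        b = p i
        kb : ℕ
        kb = M ∸ i

        i+kb≡M : i + kb ≡ M
        i+kb≡M = m+[n∸m]≡n (<⇒≤ i<M)

        Lb : Dist G a b kb
        Lb = Geodesic.level P i kb i+kb≡M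

        Dbx : Dist G b x i
        Dbx = dist-from-start P i (<⇒≤ i<M)

        Dbv : Dist G b v (suc i)
        Dbv = snocʷ (proj₁ Dbx) (Adj-sym v~x) , LB-cast (level-gap′ Lb Dv) (∸-from-+ (cong suc i+kb≡M))

        b-lower : ∀ {u} → Dist G a u M → LB b u i
        b-lower Du = LB-cast (level-gap′ Lb Du) (m∸[m∸n]≡n (<⇒≤ i<M))

        b-upper : ∀ {w D} → Dist G b w i → Dist G a w D → D ≤ M
        b-upper {D = D} Dw DD = subst (D ≤_) (trans (+-comm kb i) i+kb≡M) (proj₂ DD _ (proj₁ Lb ++ʷ proj₁ Dw))

        -- A vertex y′ in the position of y is at distance at least i + 2 from b:
        -- at distance i it would contradict SC at level i around b, and at
        -- distance i + 1, TC and SC at level i around b produce a common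
        -- neighbour of x and y′ of level M.
        y′-far : ∀ {y′} → Dist G a y′ M → Adj v y′ → ¬ (x ≡ y′) → ¬ Adj x y′ →
          ∀ D → Dist G b y′ D → D < suc (suc i) → ⊥
        y′-far {y′} Dy′ v~y′ x≢y′ x≁y′ D DD D≤i+1 with attained? (≤-pred D≤i+1)
        ... | inj₁ D≤i = sc< i i<M b v x y′ Dbv Dbx (Dist-cast DD (b-lower Dy′ D (proj₁ DD)) (≤-pred D≤i))
                           v~x v~y′ x≢y′ x≁y′
        ... | inj₂ refl = tc< i i<M b v y′ Dbv DD v~y′ λ (w , w~v , w~y′ , Dw) →
                sc< i i<M b v x w Dbv Dbx Dw v~x (Adj-sym w~v) (λ { refl → x≁y′ w~y′ })
                  λ x~w → withDist conn a w λ (D′ , DD′) →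
                    no-common-neighbour Dy′ v~y′ x≢y′ x≁y′
                      (Dist-cast DD′ (≤-pred (level-adj w~v DD′ Dv)) (b-upper Dw DD′)) (Adj-sym x~w) w~y′

        -- By y′-far, the path b … x v y is a shortest one.
        Dby : ¬ ¬ Dist G b y (suc (suc i))
        Dby ¬Dby = withDist conn b y λ (D , DD) →
          by-cases D DD (attained? (subst (D ≤_) (+-comm i 2) (proj₂ DD _ (proj₁ Dbx ++ʷ step (Adj-sym v~x) (edgeʷ v~y)))))
          where
          by-cases : ∀ D → Dist G b y D → D < suc (suc i) ⊎ D ≡ suc (suc i) → ⊥
          by-cases D DD (inj₁ D≤i+1) = y′-far Dy v~y x≢y x≁y D DD D≤i+1
          by-cases D DD (inj₂ refl) = ¬Dby DD

        v-far : ∀ w k → suc k ≡ M → Adj w y → Dist G a w k → ¬ Adj v w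
        v-far w k k+1≡M _ Dw = level-¬Adj Dv Dw (≤-reflexive (cong suc k+1≡M))

        -- A common neighbour w of v, y and q′ 1 at distance i + 1 from b has
        -- level M; if it is adjacent to x this contradicts no-common-neighbour,
        -- otherwise y′-far applied to w.
        top-plateau : ∀ q′ → Geodesic a y M q′ → ∀ w → Adj v w → Adj w y → Adj w (q′ 1) →
          Dist G b w (1 + i) → Dist G b (q′ 1) (suc (1 + i)) → ⊥
        top-plateau q′ Q′ w v~w w~y w~q₁ Dw _ = withDist conn a w λ (D , DD) →
          let Lw = Dist-cast DD (≤-pred (level-adj (Adj-sym v~w) DD Dv))
                                (level-adj (Adj-sym w~q₁) (Geodesic.level Q′ 1 m refl) DD)
          in ¬¬-excluded-middle {A = Adj x w} λ
            { (yes x~w) → no-common-neighbour Dy v~y x≢y x≁y Lw (Adj-sym x~w) w~y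
            ; (no x≁w) → y′-far Lw v~w (level-≢ Dbx Dw (λ eq → <-irrefl eq ≤-refl)) x≁w (suc i) Dw ≤-refl }

        private
          shifted : ∀ {j} → i + suc j < M → j + suc i < M
          shifted {j} = subst (_< M) (trans (+-comm i (suc j)) (sym (+-suc j i)))

        open Ascent conn a b v y M i 1
          (λ j i+j+1<M → tc< (j + suc i) (shifted i+j+1<M))
          (λ j i+j+1<M → sc< (j + suc i) (shifted i+j+1<M))
          Dbv v~y Dv v-far top-plateau

        -- After M − i − 1 ascending steps the distance from b is M + 1, so one
        -- step further it is at least M.
        anchor : LB b (q (M ∸ i)) M
        anchor = subst (λ z → LB b (q z) M) j+1≡M-i λ ℓ w →
          subst (_≤ ℓ) j+i+1≡M (≤-pred (ascent Dby q Q j (≤-reflexive (m+[n∸m]≡n i<M)) _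
            (snocʷ w (Adj-sym (Geodesic.adjacent Q j j+1≤M)))))
          where
          j : ℕ
          j = M ∸ suc i
          j+1≡M-i : suc j ≡ M ∸ i
          j+1≡M-i = sym (+-∸-assoc 1 i<M)
          j+1≤M : suc j ≤ M
          j+1≤M = subst (_≤ M) (sym j+1≡M-i) (m∸n≤m M i)
          j+i+1≡M : j + suc i ≡ M
          j+i+1≡M = trans (+-suc j i) (trans (cong suc (+-comm j i)) (m+[n∸m]≡n i<M))

        cross : ∀ j d e → j < M → i + d + j ≡ M + M → d + e ≡ suc (M + M + 1) → LB b (q j) (d ⊓ e)
        cross = cross-bound Q i 1 i<M (ascent Dby q Q) anchor

      contradiction : ⊥
      contradiction = LongCycle.contradiction P Q (apex-cap v (Adj-sym v~y) v~x Dv) bridged (s≤s z≤n) 3≤2M+1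
        λ i j d e i<M → Base.cross i i<M j d e
        where
        3≤2M+1 : 3 ≤ M + M + 1
        3≤2M+1 = +-monoˡ-≤ 1 (+-mono-≤ (s≤s z≤n) (s≤s z≤n))

    tc-step : ∀ m → (∀ t → t < m → TC t) → (∀ t → t ≤ m → SC t) → TC m
    tc-step zero _ _ a x y Dx Dy _ ¬w = ¬w (a , walk1⇒Adj (proj₁ Dx) , walk1⇒Adj (proj₁ Dy) , Dist-refl)
    tc-step (suc m) tc< sc≤ a x y Dx Dy x~y ¬w =
      TriangleStep.contradiction m tc< sc≤ a x y Dx Dy x~y ¬w (proj₂ (geodesic Dx)) (proj₂ (geodesic Dy))

    sc-step : ∀ m → (∀ t → t < m → TC t) → (∀ t → t < m → SC t) → SC m
    sc-step zero _ _ a v x y _ Dx Dy _ _ x≢y _ = x≢y (trans (sym (Dist0⇒≡ Dx)) (Dist0⇒≡ Dy))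
    sc-step (suc m) tc< sc< a v x y Dv Dx Dy v~x v~y x≢y x≁y =
      SquareStep.contradiction m tc< sc< a v x y Dv Dx Dy v~x v~y x≢y x≁y (proj₂ (geodesic Dx)) (proj₂ (geodesic Dy))

    private
      extend : {P : ℕ → Set} {m : ℕ} → (∀ t → t < m → P t) → P m → ∀ t → t ≤ m → P t
      extend below at t t≤m with attained? t≤m
      ... | inj₁ t<m = below t t<m
      ... | inj₂ refl = at

    level-conditions : ∀ m → (∀ t → t < m → TC t) × (∀ t → t < m → SC t)
    level-conditions zero = (λ _ ()) , (λ _ ())
    level-conditions (suc m) = (λ t t<m+1 → tc≤ t (≤-pred t<m+1)) , (λ t t<m+1 → sc≤ t (≤-pred t<m+1))
      where
      tc< : ∀ t → t < m → TC t
      tc< = proj₁ (level-conditions m)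
      sc< : ∀ t → t < m → SC t
      sc< = proj₂ (level-conditions m)
      sc≤ : ∀ t → t ≤ m → SC t
      sc≤ = extend sc< (sc-step m tc< sc<)
      tc≤ : ∀ t → t ≤ m → TC t
      tc≤ = extend tc< (tc-step m tc< sc≤)

    tc : ∀ m → TC m
    tc m = proj₁ (level-conditions (suc m)) m ≤-refl

    sc : ∀ m → SC m
    sc m = proj₂ (level-conditions (suc m)) m ≤-refl

    -- Descent: TC yields vertices w₁, w₂, w₃ of level k below the edges xy, yz,
    -- xz of a triangle of level k + 1.  By K4-freeness w₁ is not adjacent to z
    -- and w₂ not to x, so they are pairwise distinct, and SC around y, z, x
    -- makes them pairwise adjacent: a triangle of level k.  At level 0 there is
    -- only u.
    sphere-triangle-free : K4-free G → ∀ k u x y z → Dist G u x k → Dist G u y k → Dist G u z k →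
      Adj x y → Adj y z → Adj x z → ⊥
    sphere-triangle-free k4 zero u x y z Dx Dy _ x~y _ _ =
      irrefl (subst (Adj x) (trans (sym (Dist0⇒≡ Dy)) (Dist0⇒≡ Dx)) x~y)
    sphere-triangle-free k4 (suc k) u x y z Dx Dy Dz x~y y~z x~z =
      tc k u x y Dx Dy x~y λ (w₁ , w₁~x , w₁~y , D₁) →
      tc k u y z Dy Dz y~z λ (w₂ , w₂~y , w₂~z , D₂) →
      tc k u x z Dx Dz x~z λ (w₃ , w₃~x , w₃~z , D₃) →
      let w₁≁z : ¬ Adj w₁ z
          w₁≁z w₁~z = k4 w₁ x y z w₁~x w₁~y w₁~z x~y x~z y~z
          w₂≁x : ¬ Adj w₂ x
          w₂≁x w₂~x = k4 w₂ x y z w₂~x w₂~y w₂~z x~y x~z y~z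
          w₁≢w₂ : ¬ (w₁ ≡ w₂)
          w₁≢w₂ eq = w₁≁z (subst (λ w → Adj w z) (sym eq) w₂~z)
          w₂≢w₃ : ¬ (w₂ ≡ w₃)
          w₂≢w₃ eq = w₂≁x (subst (λ w → Adj w x) (sym eq) w₃~x)
          w₁≢w₃ : ¬ (w₁ ≡ w₃)
          w₁≢w₃ eq = w₁≁z (subst (λ w → Adj w z) (sym eq) w₃~z)
      in ¬¬-excluded-middle {A = Adj w₁ w₂} λ
        { (no w₁≁w₂) → sc k u y w₁ w₂ Dy D₁ D₂ (Adj-sym w₁~y) (Adj-sym w₂~y) w₁≢w₂ w₁≁w₂
        ; (yes w₁~w₂) → ¬¬-excluded-middle {A = Adj w₂ w₃} λ
          { (no w₂≁w₃) → sc k u z w₂ w₃ Dz D₂ D₃ (Adj-sym w₂~z) (Adj-sym w₃~z) w₂≢w₃ w₂≁w₃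
          ; (yes w₂~w₃) → ¬¬-excluded-middle {A = Adj w₁ w₃} λ
            { (no w₁≁w₃) → sc k u x w₁ w₃ Dx D₁ D₃ (Adj-sym w₁~x) (Adj-sym w₃~x) w₁≢w₃ w₁≁w₃
            ; (yes w₁~w₃) → sphere-triangle-free k4 k u w₁ w₂ w₃ D₁ D₂ D₃ w₁~w₂ w₂~w₃ w₁~w₃ } } }

lemma4 : (G : Graph) → Connected G → Bridged G → K4-free G →
    (u : Fin (Graph.n G)) (k : ℕ) (x y z : Fin (Graph.n G)) →
    InSphere G u k x → InSphere G u k y → InSphere G u k z →
    Graph.Adj G x y → Graph.Adj G y z → Graph.Adj G x z → ⊥
lemma4 G conn bridged k4 u k x y z Dx Dy Dz x~y y~z x~z =
  sphere-triangle-free G conn bridged k4 k u x y z Dx Dy Dz x~y y~z x~z
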